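{- Let $r\ge 2$ be an integer and let $\mathcal{H}=(\mathcal{V},\mathcal{E})$ be an $r$-uniform bi-hypergraph. Then $\mathcal{H}$ is colorable if at least one of the following holds: (i) $\mathcal{H}$ has fewer than $(r-1)^{r-1}$ edges; (ii) every edge of $\mathcal{H}$ intersects fewer than $(r-1)^{r-1}\mathrm{e}^{ -1}-1$ other edges of $\mathcal{H}$, where $\mathrm{e}\approx 2.71828$ is the base of the natural logarithm.
   Context: A bi-hypergraph is a pair $\mathcal{H}=(\mathcal{V},\mathcal{E})$ where $\mathcal{V}$ is a finite set (vertices) and $\mathcal{E}$ is a Sperner family of subsets of $\mathcal{V}$ (edges), i.e., no edge is contained in another edge. It is $r$-uniform if every edge has exactly $r$ elements. A mapping $f:\mathcal{V}\to\mathbb{N}$ (positive integers) is a proper coloring if $1<|f(e)|<|e|$ for every $e\in\mathcal{E}$, where $f(e)=\{f(v):v\in e\}$; $\mathcal{H}$ is colorable if it has a proper coloring. Two distinct edges are incident if they share a vertex. -}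

module Defs where

open import Data.Nat as ℕ using (ℕ; zero; suc; _!; _^_; _∸_)
open import Data.Nat.Properties using (_!≢0)
open import Data.Bool using (Bool; true; false; _∧_; not)
open import Data.Fin using (Fin)
open import Data.Fin.Subset using (Subset; _∈_; _⊆_; _∩_; ∣_∣)
open import Data.Fin.Subset.Properties using (_∈?_)
open import Data.Fin.Properties using () renaming (_≟_ to _≟ᶠ_)
open import Data.List using (List; length; map; filter; deduplicate; allFin)
open import Data.Vec using (tabulate)
open import Data.Integer using (+_)
open import Data.Rational using (ℚ; _/_; _+_; _≤_; _<_; 0ℚ)
open import Data.Product using (Σ; _×_)
open import Relation.Nullary using (¬_; Dec; yes; no)
open import Relation.Binary.PropositionalEquality using (_≢_)

-- Bi-hypergraph: the edge family is Sperner (no edge contained in a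
-- different edge; this also forces the edges to be pairwise distinct).
Sperner : ∀ {n m} → (Fin m → Subset n) → Set
Sperner {m = m} E = (i j : Fin m) → i ≢ j → ¬ (E i ⊆ E j)

Uniform : ∀ {n m} → ℕ → (Fin m → Subset n) → Set
Uniform {m = m} r E = (i : Fin m) → ∣ E i ∣ ≡ r
  where open import Relation.Binary.PropositionalEquality using (_≡_)

elems : ∀ {n} → Subset n → List (Fin n)
elems e = filter (_∈? e) (allFin _)

colourCount : ∀ {n} → (Fin n → ℕ) → Subset n → ℕ
colourCount f e = length (deduplicate ℕ._≟_ (map f (elems e)))

ProperColouring : ∀ {n m} → (Fin m → Subset n) → (Fin n → ℕ) → Set
ProperColouring {m = m} E f =
  (i : Fin m) → (1 ℕ.< colourCount f (E i)) × (colourCount f (E i) ℕ.< ∣ E i ∣)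

-- positive-integer colours: we shift by one, colour c : ℕ stands for c+1,
-- which does not affect the count of distinct colours.
Colourable : ∀ {n m} → (Fin m → Subset n) → Set
Colourable {n} E = Σ (Fin n → ℕ) (ProperColouring E)

isInc : ∀ {n m} → (Fin m → Subset n) → Fin m → Fin m → Bool
isInc E i j with i ≟ᶠ j
... | yes _ = false
... | no  _ = 0 ℕ.<ᵇ ∣ E i ∩ E j ∣

degree : ∀ {n m} → (Fin m → Subset n) → Fin m → ℕ
degree E i = ∣ tabulate (isInc E i) ∣

expPartial : ℕ → ℚ
expPartial zero = (+ 1 / 1)
expPartial (suc k) = expPartial k + (+ 1 / (suc k !)) {{suc k !≢0}}

-- "e < q": e = sup_k expPartial k, and sup < q means some q' < q bounds
-- all partial sums.
e<_ : ℚ → Set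
e< q = Σ ℚ λ q' → (q' < q) × ((k : ℕ) → expPartial k ≤ q')

module Submission where

-- Colour the vertices with k = r − 1 colours: then no edge can be rainbow, so a colouring is proper
-- as soon as no edge is monochromatic, and a fixed edge is monochromatic with probability
-- k · k^(−r) = 1/K, K = (r − 1)^(r − 1). Counting colourings, (i) is the union bound m/K < 1, and (ii)
-- is the symmetric local lemma e·(D + 1)/K < 1 for the maximum degree D, proved by the usual
-- induction on the set of edges conditioned to be non-monochromatic. The constant e enters through
-- (1 + 1/D)^D ≤ ∑_{j ≤ D} 1/j!, which turns e·(D + 1) < K into (D + 1)^(D + 1) < D^D·K.

open import Defs

module ExpNumerator where

  open import Data.Nat
  open import Data.Nat.Properties
  open import Data.Nat.Tactic.RingSolver using (solve-∀)
  open import Relation.Binary.PropositionalEquality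

  -- antidiagonalSum n F = ∑_{i + j = n} F i j
  antidiagonalSum : ℕ → (ℕ → ℕ → ℕ) → ℕ
  antidiagonalSum zero    F = F 0 0
  antidiagonalSum (suc n) F = F 0 (suc n) + antidiagonalSum n (λ i j → F (suc i) j)

  antidiagonalSum-cong : ∀ n {F G} → (∀ i j → i + j ≡ n → F i j ≡ G i j) →
                         antidiagonalSum n F ≡ antidiagonalSum n G
  antidiagonalSum-cong zero    F≡G = F≡G 0 0 refl
  antidiagonalSum-cong (suc n) F≡G =
    cong₂ _+_ (F≡G 0 (suc n) refl) (antidiagonalSum-cong n (λ i j e → F≡G (suc i) j (cong suc e)))

  antidiagonalSum-mono-≤ : ∀ n {F G} → (∀ i j → i + j ≡ n → F i j ≤ G i j) →
                           antidiagonalSum n F ≤ antidiagonalSum n G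
  antidiagonalSum-mono-≤ zero    F≤G = F≤G 0 0 refl
  antidiagonalSum-mono-≤ (suc n) F≤G =
    +-mono-≤ (F≤G 0 (suc n) refl) (antidiagonalSum-mono-≤ n (λ i j e → F≤G (suc i) j (cong suc e)))

  antidiagonalSum-distrib-+ : ∀ n F G →
    antidiagonalSum n (λ i j → F i j + G i j) ≡ antidiagonalSum n F + antidiagonalSum n G
  antidiagonalSum-distrib-+ zero    F G = refl
  antidiagonalSum-distrib-+ (suc n) F G =
    trans (cong (F 0 (suc n) + G 0 (suc n) +_) (antidiagonalSum-distrib-+ n _ _))
          (+-+-comm (F 0 (suc n)) (G 0 (suc n)) _ _)
    where
    +-+-comm : ∀ a b c d → a + b + (c + d) ≡ a + c + (b + d)
    +-+-comm = solve-∀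

  *-distribˡ-antidiagonalSum : ∀ n a F → a * antidiagonalSum n F ≡ antidiagonalSum n (λ i j → a * F i j)
  *-distribˡ-antidiagonalSum zero    a F = refl
  *-distribˡ-antidiagonalSum (suc n) a F =
    trans (*-distribˡ-+ a (F 0 (suc n)) _) (cong (a * F 0 (suc n) +_) (*-distribˡ-antidiagonalSum n a _))

  antidiagonalSum-suc : ∀ n F → antidiagonalSum (suc n) F ≡ antidiagonalSum n (λ i j → F i (suc j)) + F (suc n) 0
  antidiagonalSum-suc zero    F = refl
  antidiagonalSum-suc (suc n) F =
    trans (cong (F 0 (suc (suc n)) +_) (antidiagonalSum-suc n (λ i j → F (suc i) j)))
          (sym (+-assoc (F 0 (suc (suc n))) _ _))

  -- pascal i j is the binomial coefficient C(i + j, i)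
  pascal : ℕ → ℕ → ℕ
  pascal zero    j       = 1
  pascal (suc i) zero    = 1
  pascal (suc i) (suc j) = pascal i (suc j) + pascal (suc i) j

  pascal-zeroʳ : ∀ i → pascal i 0 ≡ 1
  pascal-zeroʳ zero    = refl
  pascal-zeroʳ (suc i) = refl

  binomial-theorem : ∀ x n → antidiagonalSum n (λ i j → pascal i j * x ^ i) ≡ suc x ^ n
  binomial-theorem x zero    = refl
  binomial-theorem x (suc n) = begin
      antidiagonalSum (suc n) term
    ≡⟨ antidiagonalSum-cong (suc n) pascal-rule ⟩
      antidiagonalSum (suc n) (λ i j → x-part i j + 1-part i j)
    ≡⟨ antidiagonalSum-distrib-+ (suc n) x-part 1-part ⟩
      antidiagonalSum (suc n) x-part + antidiagonalSum (suc n) 1-part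
    ≡⟨ cong₂ _+_ (sym (*-distribˡ-antidiagonalSum n x term))
                 (trans (antidiagonalSum-suc n 1-part) (+-identityʳ _)) ⟩
      x * antidiagonalSum n term + antidiagonalSum n term
    ≡⟨ cong (λ s → x * s + s) (binomial-theorem x n) ⟩
      x * suc x ^ n + suc x ^ n
    ≡⟨ +-comm (x * suc x ^ n) _ ⟩
      suc x ^ suc n ∎
    where
    open ≡-Reasoning
    term : ℕ → ℕ → ℕ
    term i j = pascal i j * x ^ i
    x-part : ℕ → ℕ → ℕ
    x-part zero    j = 0
    x-part (suc i) j = x * term i j
    1-part : ℕ → ℕ → ℕ
    1-part i zero    = 0
    1-part i (suc j) = term i j
    pascal-rule : ∀ i j → i + j ≡ suc n → term i j ≡ x-part i j + 1-part i j
    pascal-rule zero    (suc j) _ = refl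
    pascal-rule (suc i) zero    _ rewrite pascal-zeroʳ i = rearrange x (x ^ i)
      where rearrange : ∀ x y → 1 * (x * y) ≡ x * (1 * y) + 0
            rearrange = solve-∀
    pascal-rule (suc i) (suc j) _ = rearrange (pascal i (suc j)) (pascal (suc i) j) x (x ^ i)
      where rearrange : ∀ a b x y → (a + b) * (x * y) ≡ x * (a * y) + b * (x * y)
            rearrange = solve-∀

  bernoulli : ∀ m j → m ^ suc j + suc j * m ^ j ≤ suc m ^ suc j
  bernoulli m zero    = ≤-reflexive (rearrange m)
    where rearrange : ∀ m → m * 1 + 1 * 1 ≡ suc m * 1
          rearrange = solve-∀
  bernoulli m (suc j) = begin
      m * (m * m ^ j) + suc (suc j) * (m * m ^ j)
    ≤⟨ m≤m+n _ (suc j * m ^ j) ⟩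
      m * (m * m ^ j) + suc (suc j) * (m * m ^ j) + suc j * m ^ j
    ≡⟨ rearrange m (m ^ j) j ⟩
      suc m * (m * m ^ j + suc j * m ^ j)
    ≤⟨ *-monoʳ-≤ (suc m) (bernoulli m j) ⟩
      suc m * suc m ^ suc j ∎
    where
    open ≤-Reasoning
    rearrange : ∀ m a j → m * (m * a) + suc (suc j) * (m * a) + suc j * a ≡ suc m * (m * a + suc j * a)
    rearrange = solve-∀

  n!≤n^n : ∀ n → n ! ≤ n ^ n
  n!≤n^n zero    = ≤-refl
  n!≤n^n (suc n) = *-monoʳ-≤ (suc n) (≤-trans (n!≤n^n n) (^-monoˡ-≤ n (n≤1+n n)))

  pascal*!≤^ : ∀ i j → pascal i j * j ! ≤ (i + j) ^ j
  pascal*!≤^ zero    j       = ≤-trans (≤-reflexive (+-identityʳ (j !))) (n!≤n^n j)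
  pascal*!≤^ (suc i) zero    = ≤-refl
  pascal*!≤^ (suc i) (suc j) = begin
      (pascal i (suc j) + pascal (suc i) j) * (suc j * j !)
    ≡⟨ rearrange (pascal i (suc j)) (pascal (suc i) j) (suc j) (j !) ⟩
      pascal i (suc j) * (suc j * j !) + suc j * (pascal (suc i) j * j !)
    ≤⟨ +-mono-≤ (pascal*!≤^ i (suc j)) (*-monoʳ-≤ (suc j) (pascal*!≤^ (suc i) j)) ⟩
      (i + suc j) ^ suc j + suc j * (suc i + j) ^ j
    ≡⟨ cong (λ s → s ^ suc j + suc j * suc (i + j) ^ j) (+-suc i j) ⟩
      suc (i + j) ^ suc j + suc j * suc (i + j) ^ j
    ≤⟨ bernoulli (suc (i + j)) j ⟩
      suc (suc (i + j)) ^ suc j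
    ≡⟨ cong (λ s → suc s ^ suc j) (sym (+-suc i j)) ⟩
      (suc i + suc j) ^ suc j ∎
    where
    open ≤-Reasoning
    rearrange : ∀ a b s f → (a + b) * (s * f) ≡ a * (s * f) + s * (b * f)
    rearrange = solve-∀

  rising : ℕ → ℕ → ℕ
  rising zero    j = 1
  rising (suc i) j = suc (i + j) * rising i j

  rising*!≡! : ∀ i j → rising i j * j ! ≡ (i + j) !
  rising*!≡! zero    j = +-identityʳ (j !)
  rising*!≡! (suc i) j = trans (*-assoc (suc (i + j)) (rising i j) (j !)) (cong (suc (i + j) *_) (rising*!≡! i j))

  -- expNumerator d = d! · expPartial d = ∑_{j ≤ d} d! / j!
  expNumerator : ℕ → ℕ
  expNumerator zero    = 1
  expNumerator (suc d) = suc (suc d * expNumerator d)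

  expNumerator≡∑rising : ∀ d → expNumerator d ≡ antidiagonalSum d rising
  expNumerator≡∑rising zero    = refl
  expNumerator≡∑rising (suc d) = cong suc (begin
      suc d * expNumerator d
    ≡⟨ cong (suc d *_) (expNumerator≡∑rising d) ⟩
      suc d * antidiagonalSum d rising
    ≡⟨ *-distribˡ-antidiagonalSum d (suc d) rising ⟩
      antidiagonalSum d (λ i j → suc d * rising i j)
    ≡⟨ antidiagonalSum-cong d (λ i j i+j≡d → cong (λ s → suc s * rising i j) (sym i+j≡d)) ⟩
      antidiagonalSum d (λ i j → rising (suc i) j) ∎)
    where open ≡-Reasoning

  pascal-term≤ : ∀ d i j → i + j ≡ d → pascal i j * d ^ i * d ! ≤ d ^ d * rising i j
  pascal-term≤ d i j i+j≡d = begin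
      pascal i j * d ^ i * d !
    ≡⟨ cong (λ s → pascal i j * d ^ i * s !) (sym i+j≡d) ⟩
      pascal i j * d ^ i * (i + j) !
    ≡⟨ cong (pascal i j * d ^ i *_) (sym (rising*!≡! i j)) ⟩
      pascal i j * d ^ i * (rising i j * j !)
    ≡⟨ rearrange (pascal i j) (d ^ i) (rising i j) (j !) ⟩
      pascal i j * j ! * (d ^ i * rising i j)
    ≤⟨ *-monoˡ-≤ (d ^ i * rising i j) (pascal*!≤^ i j) ⟩
      (i + j) ^ j * (d ^ i * rising i j)
    ≡⟨ cong (λ s → s ^ j * (d ^ i * rising i j)) i+j≡d ⟩
      d ^ j * (d ^ i * rising i j)
    ≡⟨ sym (*-assoc (d ^ j) (d ^ i) (rising i j)) ⟩
      d ^ j * d ^ i * rising i j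
    ≡⟨ cong (_* rising i j) (sym (^-distribˡ-+-* d j i)) ⟩
      d ^ (j + i) * rising i j
    ≡⟨ cong (λ s → d ^ s * rising i j) (trans (+-comm j i) i+j≡d) ⟩
      d ^ d * rising i j ∎
    where
    open ≤-Reasoning
    rearrange : ∀ b p c f → b * p * (c * f) ≡ b * f * (p * c)
    rearrange = solve-∀

  -- (1 + 1/d)^d ≤ ∑_{j ≤ d} 1/j!, cleared of denominators
  [1+d]^d*d!≤d^d*expNumerator : ∀ d → suc d ^ d * d ! ≤ d ^ d * expNumerator d
  [1+d]^d*d!≤d^d*expNumerator d = begin
      suc d ^ d * d !
    ≡⟨ cong (_* d !) (sym (binomial-theorem d d)) ⟩
      antidiagonalSum d (λ i j → pascal i j * d ^ i) * d !
    ≡⟨ *-comm _ (d !) ⟩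
      d ! * antidiagonalSum d (λ i j → pascal i j * d ^ i)
    ≡⟨ *-distribˡ-antidiagonalSum d (d !) _ ⟩
      antidiagonalSum d (λ i j → d ! * (pascal i j * d ^ i))
    ≤⟨ antidiagonalSum-mono-≤ d (λ i j i+j≡d →
         ≤-trans (≤-reflexive (*-comm (d !) _)) (pascal-term≤ d i j i+j≡d)) ⟩
      antidiagonalSum d (λ i j → d ^ d * rising i j)
    ≡⟨ sym (*-distribˡ-antidiagonalSum d (d ^ d) rising) ⟩
      d ^ d * antidiagonalSum d rising
    ≡⟨ cong (d ^ d *_) (sym (expNumerator≡∑rising d)) ⟩
      d ^ d * expNumerator d ∎
    where open ≤-Reasoning

  n^n>0 : ∀ n → 0 < n ^ n
  n^n>0 zero    = s≤s z≤n
  n^n>0 (suc n) = m^n>0 (suc n) (suc n)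

  [1+d]^[1+d]<d^d*K : ∀ d K → expNumerator d * suc d < K * d ! → suc d ^ suc d < d ^ d * K
  [1+d]^[1+d]<d^d*K d K e[1+d]<K = *-cancelʳ-< (d !) (suc d ^ suc d) (d ^ d * K) (begin-strict
      suc d * suc d ^ d * d !
    ≡⟨ *-assoc (suc d) (suc d ^ d) (d !) ⟩
      suc d * (suc d ^ d * d !)
    ≤⟨ *-monoʳ-≤ (suc d) ([1+d]^d*d!≤d^d*expNumerator d) ⟩
      suc d * (d ^ d * expNumerator d)
    ≡⟨ rearrange (suc d) (d ^ d) (expNumerator d) ⟩
      d ^ d * (expNumerator d * suc d)
    <⟨ *-monoʳ-< (d ^ d) ⦃ >-nonZero (n^n>0 d) ⦄ e[1+d]<K ⟩
      d ^ d * (K * d !)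
    ≡⟨ sym (*-assoc (d ^ d) K (d !)) ⟩
      d ^ d * K * d ! ∎)
    where
    open ≤-Reasoning
    rearrange : ∀ s p e → s * (p * e) ≡ p * (e * s)
    rearrange = solve-∀

module ExpPartial where

  open ExpNumerator using (expNumerator)
  open import Data.Nat as ℕ using (ℕ; zero; suc; _!; NonZero)
  open import Data.Nat.Properties using (_!≢0)
  open import Data.Nat.Tactic.RingSolver using (solve-∀)
  open import Data.Integer as ℤ using (+_)
  import Data.Integer.Properties as ℤ
  open import Data.Rational as ℚ using (_/_; toℚᵘ)
  import Data.Rational.Properties as ℚ
  open import Data.Rational.Unnormalised as ℚᵘ using (mkℚᵘ; *≡*; *<*; _≃_)
  import Data.Rational.Unnormalised.Properties as ℚᵘ
  open import Data.Product using (Σ-syntax; _,_)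
  open import Relation.Binary.PropositionalEquality

  -- mkℚᵘ p b denotes p / (b + 1)
  /-as-mkℚᵘ : ∀ a q .⦃ _ : NonZero q ⦄ b → q ≡ suc b → toℚᵘ (+ a / q) ≃ mkℚᵘ (+ a) b
  /-as-mkℚᵘ a .(suc b) b refl = ℚ.toℚᵘ-fromℚᵘ (mkℚᵘ (+ a) b)

  mkℚᵘ-cong : ∀ a b c d → a ℕ.* suc d ≡ c ℕ.* suc b → mkℚᵘ (+ a) b ≃ mkℚᵘ (+ c) d
  mkℚᵘ-cong a b c d eq = *≡* (trans (sym (ℤ.pos-* a (suc d))) (trans (cong +_ eq) (ℤ.pos-* c (suc b))))

  mkℚᵘ-+ : ∀ a b c d →
    mkℚᵘ (+ a) b ℚᵘ.+ mkℚᵘ (+ c) d ≃ mkℚᵘ (+ (a ℕ.* suc d ℕ.+ c ℕ.* suc b)) (d ℕ.+ b ℕ.* suc d)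
  mkℚᵘ-+ a b c d = ℚᵘ.≃-reflexive (cong (λ z → mkℚᵘ z (d ℕ.+ b ℕ.* suc d))
    (sym (trans (ℤ.pos-+ (a ℕ.* suc d) (c ℕ.* suc b)) (cong₂ ℤ._+_ (ℤ.pos-* a (suc d)) (ℤ.pos-* c (suc b))))))

  mkℚᵘ-<⇒ : ∀ a b c d → mkℚᵘ (+ a) b ℚᵘ.< mkℚᵘ (+ c) d → a ℕ.* suc d ℕ.< c ℕ.* suc b
  mkℚᵘ-<⇒ a b c d (*<* lt) = ℤ.drop‿+<+ (subst₂ ℤ._<_ (sym (ℤ.pos-* a (suc d))) (sym (ℤ.pos-* c (suc b))) lt)

  n!≡suc : ∀ n → Σ[ b ∈ ℕ ] n ! ≡ suc b
  n!≡suc n with n ! | n !≢0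
  ... | suc b | _ = b , refl

  expPartial≃ : ∀ k b → k ! ≡ suc b → toℚᵘ (expPartial k) ≃ mkℚᵘ (+ expNumerator k) b
  expPartial≃ zero    .0 refl = ℚ.toℚᵘ-fromℚᵘ (mkℚᵘ (+ 1) 0)
  expPartial≃ (suc k) b [1+k]!≡1+b with n!≡suc k
  ... | b₀ , k!≡1+b₀ = begin
      toℚᵘ (expPartial k ℚ.+ (+ 1 / suc k !) ⦃ suc k !≢0 ⦄)
    ≈⟨ ℚ.toℚᵘ-homo-+ (expPartial k) _ ⟩
      toℚᵘ (expPartial k) ℚᵘ.+ toℚᵘ ((+ 1 / suc k !) ⦃ suc k !≢0 ⦄)
    ≈⟨ ℚᵘ.+-cong (expPartial≃ k b₀ k!≡1+b₀) (/-as-mkℚᵘ 1 (suc k !) ⦃ suc k !≢0 ⦄ b [1+k]!≡1+b) ⟩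
      mkℚᵘ (+ expNumerator k) b₀ ℚᵘ.+ mkℚᵘ (+ 1) b
    ≈⟨ mkℚᵘ-+ (expNumerator k) b₀ 1 b ⟩
      _
    ≈⟨ mkℚᵘ-cong _ _ _ _ (cross-multiplied (expNumerator k) k b₀ (suc b) 1+b≡[1+k][1+b₀]) ⟩
      mkℚᵘ (+ expNumerator (suc k)) b ∎
    where
    open ℚᵘ.≃-Reasoning
    1+b≡[1+k][1+b₀] : suc b ≡ suc k ℕ.* suc b₀
    1+b≡[1+k][1+b₀] = trans (sym [1+k]!≡1+b) (cong (suc k ℕ.*_) k!≡1+b₀)
    identity : ∀ e k x → (e ℕ.* (suc k ℕ.* suc x) ℕ.+ 1 ℕ.* suc x) ℕ.* (suc k ℕ.* suc x)
                         ≡ suc (suc k ℕ.* e) ℕ.* (suc x ℕ.* (suc k ℕ.* suc x))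
    identity = solve-∀
    cross-multiplied : ∀ e k x y → y ≡ suc k ℕ.* suc x →
      (e ℕ.* y ℕ.+ 1 ℕ.* suc x) ℕ.* y ≡ suc (suc k ℕ.* e) ℕ.* (suc x ℕ.* y)
    cross-multiplied e k x .(suc k ℕ.* suc x) refl = identity e k x

  e<⇒expNumerator-bound : ∀ d K → e< (+ K / suc d) → expNumerator d ℕ.* suc d ℕ.< K ℕ.* d !
  e<⇒expNumerator-bound d K (q , q<K/[1+d] , expPartial≤q) with n!≡suc d
  ... | b , d!≡1+b = subst (λ z → expNumerator d ℕ.* suc d ℕ.< K ℕ.* z) (sym d!≡1+b)
    (mkℚᵘ-<⇒ (expNumerator d) b K d
      (ℚᵘ.<-respʳ-≃ (ℚ.toℚᵘ-fromℚᵘ (mkℚᵘ (+ K) d))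
        (ℚᵘ.<-respˡ-≃ (expPartial≃ d b d!≡1+b)
          (ℚ.toℚᵘ-mono-< (ℚ.≤-<-trans (expPartial≤q d) q<K/[1+d])))))

module Counting where

  open import Data.Nat hiding (_≟_)
  open import Data.Nat.Properties hiding (_≟_)
  open import Data.Nat.Tactic.RingSolver using (solve-∀)
  open import Data.Bool using (Bool; true; false; _∧_; _∨_; not)
  open import Data.Fin using (Fin; zero; suc; _≟_)
  open import Data.Fin.Subset using (Subset; ∣_∣)
  open import Data.Vec using ([]; _∷_; lookup)
  open import Data.Vec.Functional using (Vector; foldr) renaming (_∷_ to _◂_)
  open import Data.Product using (∃; _×_; _,_)
  open import Function using (_∘_)
  open import Relation.Nullary using (does; yes; no)
  open import Relation.Binary.PropositionalEquality
  open import Algebra.Properties.Semiring.Sum +-*-semiring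
    using (sum; sum-syntax; sum-cong-≗; ∑-distrib-+; ∑-comm; *-distribˡ-sum; *-distribʳ-sum)

  sum-mono-≤ : ∀ {j} {f g : Vector ℕ j} → (∀ c → f c ≤ g c) → sum f ≤ sum g
  sum-mono-≤ {zero}  f≤g = z≤n
  sum-mono-≤ {suc j} f≤g = +-mono-≤ (f≤g zero) (sum-mono-≤ (f≤g ∘ suc))

  sum-const : ∀ j a → ∑[ c < j ] a ≡ j * a
  sum-const zero    a = refl
  sum-const (suc j) a = cong (a +_) (sum-const j a)

  sum>0⇒∃>0 : ∀ {j} (f : Vector ℕ j) → 0 < sum f → ∃ λ c → 0 < f c
  sum>0⇒∃>0 {suc j} f sum>0 with f zero in eq
  ... | suc _ = zero , subst (0 <_) (sym eq) (s≤s z≤n)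
  ... | zero with sum>0⇒∃>0 (f ∘ suc) sum>0
  ...   | c , fc>0 = suc c , fc>0

  𝟙 : Bool → ℕ
  𝟙 true  = 1
  𝟙 false = 0

  𝟙≤1 : ∀ b → 𝟙 b ≤ 1
  𝟙≤1 true  = ≤-refl
  𝟙≤1 false = z≤n

  𝟙-∧ : ∀ a b → 𝟙 (a ∧ b) ≡ 𝟙 a * 𝟙 b
  𝟙-∧ true  b = sym (+-identityʳ (𝟙 b))
  𝟙-∧ false b = refl

  ∑𝟙[≟]≤1 : ∀ {j} (c : Fin j) → ∑[ c′ < j ] 𝟙 (does (c′ ≟ c)) ≤ 1
  ∑𝟙[≟]≤1 {suc j} zero    = ≤-reflexive (cong suc (trans (sum-const j 0) (*-zeroʳ j)))
  ∑𝟙[≟]≤1 {suc j} (suc c) = ∑𝟙[≟]≤1 c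

  foldr-cong : ∀ {A B : Set} (_⊕_ : A → B → B) z {j} {p q : Vector A j} →
               (∀ c → p c ≡ q c) → foldr _⊕_ z p ≡ foldr _⊕_ z q
  foldr-cong _⊕_ z {zero}  p≗q = refl
  foldr-cong _⊕_ z {suc j} p≗q = cong₂ _⊕_ (p≗q zero) (foldr-cong _⊕_ z (p≗q ∘ suc))

  𝟙-any≤∑ : ∀ {j} (p : Vector Bool j) → 𝟙 (foldr _∨_ false p) ≤ sum (𝟙 ∘ p)
  𝟙-any≤∑ {zero}  p = z≤n
  𝟙-any≤∑ {suc j} p with p zero
  ... | true  = s≤s z≤n
  ... | false = 𝟙-any≤∑ (p ∘ suc)

  module Colourings (k : ℕ) where

    Colouring : ℕ → Set
    Colouring = Vector (Fin k)

    ∑ᶜ : ∀ {n} → (Colouring n → ℕ) → ℕ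
    ∑ᶜ {zero}  h = h (λ ())
    ∑ᶜ {suc n} h = ∑[ c < k ] ∑ᶜ (λ g → h (c ◂ g))

    ∑ᶜ-cong : ∀ {n} {h h′ : Colouring n → ℕ} → (∀ f → h f ≡ h′ f) → ∑ᶜ h ≡ ∑ᶜ h′
    ∑ᶜ-cong {zero}  h≡h′ = h≡h′ _
    ∑ᶜ-cong {suc n} h≡h′ = sum-cong-≗ (λ c → ∑ᶜ-cong (λ g → h≡h′ (c ◂ g)))

    ∑ᶜ-mono-≤ : ∀ {n} {h h′ : Colouring n → ℕ} → (∀ f → h f ≤ h′ f) → ∑ᶜ h ≤ ∑ᶜ h′
    ∑ᶜ-mono-≤ {zero}  h≤h′ = h≤h′ _
    ∑ᶜ-mono-≤ {suc n} h≤h′ = sum-mono-≤ (λ c → ∑ᶜ-mono-≤ (λ g → h≤h′ (c ◂ g)))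

    ∑ᶜ-distrib-+ : ∀ {n} (h h′ : Colouring n → ℕ) → ∑ᶜ (λ f → h f + h′ f) ≡ ∑ᶜ h + ∑ᶜ h′
    ∑ᶜ-distrib-+ {zero}  h h′ = refl
    ∑ᶜ-distrib-+ {suc n} h h′ =
      trans (sum-cong-≗ (λ c → ∑ᶜ-distrib-+ (λ g → h (c ◂ g)) (λ g → h′ (c ◂ g))))
            (∑-distrib-+ (λ c → ∑ᶜ (λ g → h (c ◂ g))) (λ c → ∑ᶜ (λ g → h′ (c ◂ g))))

    *-distribˡ-∑ᶜ : ∀ {n} a (h : Colouring n → ℕ) → a * ∑ᶜ h ≡ ∑ᶜ (λ f → a * h f)
    *-distribˡ-∑ᶜ {zero}  a h = refl
    *-distribˡ-∑ᶜ {suc n} a h =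
      trans (*-distribˡ-sum a (λ c → ∑ᶜ (λ g → h (c ◂ g))))
            (sum-cong-≗ (λ c → *-distribˡ-∑ᶜ a (λ g → h (c ◂ g))))

    ∑ᶜ-const : ∀ n a → ∑ᶜ {n} (λ _ → a) ≡ k ^ n * a
    ∑ᶜ-const zero    a = sym (+-identityʳ a)
    ∑ᶜ-const (suc n) a =
      trans (sum-const k _) (trans (cong (k *_) (∑ᶜ-const n a)) (sym (*-assoc k (k ^ n) a)))

    ∑ᶜ-comm : ∀ {n j} (H : Fin j → Colouring n → ℕ) →
              ∑ᶜ (λ f → ∑[ c < j ] H c f) ≡ ∑[ c < j ] ∑ᶜ (H c)
    ∑ᶜ-comm {zero}  H = refl
    ∑ᶜ-comm {suc n} H =
      trans (sum-cong-≗ (λ c′ → ∑ᶜ-comm (λ c g → H c (c′ ◂ g))))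
            (∑-comm (λ c′ c → ∑ᶜ (λ g → H c (c′ ◂ g))))

    ∑ᶜ>0⇒∃>0 : ∀ {n} (h : Colouring n → ℕ) → 0 < ∑ᶜ h → ∃ λ f → 0 < h f
    ∑ᶜ>0⇒∃>0 {zero}  h ∑>0 = _ , ∑>0
    ∑ᶜ>0⇒∃>0 {suc n} h ∑>0 with sum>0⇒∃>0 _ ∑>0
    ... | c , ∑c>0 with ∑ᶜ>0⇒∃>0 _ ∑c>0
    ...   | g , hg>0 = c ◂ g , hg>0

    monochromaticIn : ∀ {n} → Fin k → Subset n → Colouring n → Bool
    monochromaticIn c []      f = true
    monochromaticIn c (b ∷ e) f = (not b ∨ does (f zero ≟ c)) ∧ monochromaticIn c e (f ∘ suc)

    monochromatic : ∀ {n} → Subset n → Colouring n → Bool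
    monochromatic e f = foldr _∨_ false (λ c → monochromaticIn c e f)

    IgnoresColoursOn : ∀ {n} → Subset n → (Colouring n → ℕ) → Set
    IgnoresColoursOn e h = ∀ f g → (∀ v → lookup e v ≡ false → f v ≡ g v) → h f ≡ h g

    ignores-tail : ∀ {n b} {e : Subset n} {h : Colouring (suc n) → ℕ} → IgnoresColoursOn (b ∷ e) h →
                   ∀ c → IgnoresColoursOn e (λ g → h (c ◂ g))
    ignores-tail ignores c f g agree = ignores (c ◂ f) (c ◂ g) λ { zero _ → refl ; (suc v) → agree v }

    ignores-head : ∀ {n} {e : Subset n} {h : Colouring (suc n) → ℕ} → IgnoresColoursOn (true ∷ e) h →
                   ∀ c c′ g → h (c′ ◂ g) ≡ h (c ◂ g)
    ignores-head ignores c c′ g = ignores _ _ λ { (suc v) _ → refl }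

    -- Each vertex of e has colour c with probability 1/k, independently of h.
    ∑ᶜ-monochromaticIn : ∀ {n} (e : Subset n) c (h : Colouring n → ℕ) → IgnoresColoursOn e h →
                         ∑ᶜ (λ f → 𝟙 (monochromaticIn c e f) * h f) * k ^ ∣ e ∣ ≤ ∑ᶜ h
    ∑ᶜ-monochromaticIn [] c h _ = ≤-reflexive (trans (*-identityʳ _) (+-identityʳ _))
    ∑ᶜ-monochromaticIn (false ∷ e) c h ignores = begin
        (∑[ c′ < k ] ∑ᶜ (λ g → 𝟙 (monochromaticIn c e g) * h (c′ ◂ g))) * k ^ ∣ e ∣
      ≡⟨ *-distribʳ-sum (k ^ ∣ e ∣) (λ c′ → ∑ᶜ (λ g → 𝟙 (monochromaticIn c e g) * h (c′ ◂ g))) ⟩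
        ∑[ c′ < k ] (∑ᶜ (λ g → 𝟙 (monochromaticIn c e g) * h (c′ ◂ g)) * k ^ ∣ e ∣)
      ≤⟨ sum-mono-≤ (λ c′ → ∑ᶜ-monochromaticIn e c _ (ignores-tail ignores c′)) ⟩
        ∑ᶜ h ∎
      where open ≤-Reasoning
    ∑ᶜ-monochromaticIn {suc n} (true ∷ e) c h ignores = begin
        (∑[ c′ < k ] ∑ᶜ (λ g → 𝟙 (does (c′ ≟ c) ∧ monochromaticIn c e g) * h (c′ ◂ g))) * (k * k ^ ∣ e ∣)
      ≡⟨ cong (_* (k * k ^ ∣ e ∣)) (sum-cong-≗ λ c′ →
           trans (∑ᶜ-cong (split c′))
                 (sym (*-distribˡ-∑ᶜ (𝟙 (does (c′ ≟ c))) (λ g → 𝟙 (monochromaticIn c e g) * h (c ◂ g))))) ⟩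
        (∑[ c′ < k ] (𝟙 (does (c′ ≟ c)) * Y)) * (k * k ^ ∣ e ∣)
      ≡⟨ cong (_* (k * k ^ ∣ e ∣)) (sym (*-distribʳ-sum Y (λ c′ → 𝟙 (does (c′ ≟ c))))) ⟩
        (∑[ c′ < k ] 𝟙 (does (c′ ≟ c))) * Y * (k * k ^ ∣ e ∣)
      ≤⟨ *-monoˡ-≤ (k * k ^ ∣ e ∣) (*-monoˡ-≤ Y (∑𝟙[≟]≤1 c)) ⟩
        1 * Y * (k * k ^ ∣ e ∣)
      ≡⟨ rearrange Y k (k ^ ∣ e ∣) ⟩
        k * (Y * k ^ ∣ e ∣)
      ≤⟨ *-monoʳ-≤ k (∑ᶜ-monochromaticIn e c _ (ignores-tail ignores c)) ⟩
        k * ∑ᶜ (λ g → h (c ◂ g))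
      ≡⟨ sym (sum-const k _) ⟩
        ∑[ c′ < k ] ∑ᶜ (λ g → h (c ◂ g))
      ≡⟨ sum-cong-≗ (λ c′ → ∑ᶜ-cong (λ g → sym (ignores-head ignores c c′ g))) ⟩
        ∑ᶜ h ∎
      where
      open ≤-Reasoning
      Y : ℕ
      Y = ∑ᶜ (λ g → 𝟙 (monochromaticIn c e g) * h (c ◂ g))
      split : ∀ c′ g → 𝟙 (does (c′ ≟ c) ∧ monochromaticIn c e g) * h (c′ ◂ g)
                     ≡ 𝟙 (does (c′ ≟ c)) * (𝟙 (monochromaticIn c e g) * h (c ◂ g))
      split c′ g rewrite 𝟙-∧ (does (c′ ≟ c)) (monochromaticIn c e g) | ignores-head ignores c c′ g =
        *-assoc (𝟙 (does (c′ ≟ c))) _ _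
      rearrange : ∀ y k p → 1 * y * (k * p) ≡ k * (y * p)
      rearrange = solve-∀

    -- An edge of size t + 1 is monochromatic with probability at most k / k^(t+1) = 1 / k^t.
    ∑ᶜ-monochromatic : ∀ {n} .⦃ _ : NonZero k ⦄ (e : Subset n) t (h : Colouring n → ℕ) →
                       IgnoresColoursOn e h → ∣ e ∣ ≡ suc t →
                       ∑ᶜ (λ f → 𝟙 (monochromatic e f) * h f) * k ^ t ≤ ∑ᶜ h
    ∑ᶜ-monochromatic e t h ignores ∣e∣≡1+t = *-cancelˡ-≤ k (begin
        k * (M * k ^ t)
      ≡⟨ rearrange M k (k ^ t) ⟩
        M * k ^ suc t
      ≡⟨ cong (λ s → M * k ^ s) (sym ∣e∣≡1+t) ⟩
        M * k ^ ∣ e ∣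
      ≤⟨ *-monoˡ-≤ (k ^ ∣ e ∣) (∑ᶜ-mono-≤ union-bound) ⟩
        ∑ᶜ (λ f → ∑[ c < k ] (𝟙 (monochromaticIn c e f) * h f)) * k ^ ∣ e ∣
      ≡⟨ cong (_* k ^ ∣ e ∣) (∑ᶜ-comm (λ c f → 𝟙 (monochromaticIn c e f) * h f)) ⟩
        (∑[ c < k ] ∑ᶜ (λ f → 𝟙 (monochromaticIn c e f) * h f)) * k ^ ∣ e ∣
      ≡⟨ *-distribʳ-sum (k ^ ∣ e ∣) (λ c → ∑ᶜ (λ f → 𝟙 (monochromaticIn c e f) * h f)) ⟩
        ∑[ c < k ] (∑ᶜ (λ f → 𝟙 (monochromaticIn c e f) * h f) * k ^ ∣ e ∣)
      ≤⟨ sum-mono-≤ (λ c → ∑ᶜ-monochromaticIn e c h ignores) ⟩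
        ∑[ c < k ] ∑ᶜ h
      ≡⟨ sum-const k _ ⟩
        k * ∑ᶜ h ∎)
      where
      open ≤-Reasoning
      M : ℕ
      M = ∑ᶜ (λ f → 𝟙 (monochromatic e f) * h f)
      rearrange : ∀ x k p → k * (x * p) ≡ x * (k * p)
      rearrange = solve-∀
      union-bound : ∀ f → 𝟙 (monochromatic e f) * h f ≤ ∑[ c < k ] (𝟙 (monochromaticIn c e f) * h f)
      union-bound f = ≤-trans (*-monoˡ-≤ (h f) (𝟙-any≤∑ (λ c → monochromaticIn c e f)))
                              (≤-reflexive (*-distribʳ-sum (h f) (λ c → 𝟙 (monochromaticIn c e f))))

    monochromatic≡false⇒ : ∀ {n} (e : Subset n) f c → monochromatic e f ≡ false → monochromaticIn c e f ≡ false
    monochromatic≡false⇒ e f c = go (λ c → monochromaticIn c e f) c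
      where
      go : ∀ {j} (p : Vector Bool j) c → foldr _∨_ false p ≡ false → p c ≡ false
      go p zero    any≡false with p zero
      ... | false = refl
      go p (suc c) any≡false with p zero
      ... | false = go (p ∘ suc) c any≡false

    monochromaticIn≡false⇒ : ∀ {n} (e : Subset n) c f → monochromaticIn c e f ≡ false →
                             ∃ λ v → lookup e v ≡ true × f v ≢ c
    monochromaticIn≡false⇒ (true ∷ e) c f ¬mono with f zero ≟ c
    ... | no f0≢c = zero , refl , f0≢c
    ... | yes _   with monochromaticIn≡false⇒ e c (f ∘ suc) ¬mono
    ...   | v , v∈e , fv≢c = suc v , v∈e , fv≢c
    monochromaticIn≡false⇒ (false ∷ e) c f ¬mono with monochromaticIn≡false⇒ e c (f ∘ suc) ¬mono
    ... | v , v∈e , fv≢c = suc v , v∈e , fv≢c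

module LocalLemma where

  open Counting
  open import Data.Nat hiding (_≟_)
  open import Data.Nat.Properties hiding (_≟_)
  open import Data.Nat.Tactic.RingSolver using (solve-∀)
  open import Data.Bool using (Bool; true; false; _∧_; _∨_; not; T; T?)
  open import Data.Empty using (⊥)
  open import Data.Bool.Properties using (∧-assoc; ∧-zeroʳ)
  open import Data.Fin using (Fin; zero; suc; _≟_)
  open import Data.Fin.Subset using (Subset; ∣_∣; _∩_)
  open import Data.Vec using ([]; _∷_; lookup)
  import Data.Vec as Vec
  open import Data.Vec.Properties using (lookup-zipWith)
  open import Data.List using (List; []; _∷_; length; _++_; filterᵇ; allFin; tabulate)
  open import Data.List.Properties using (length-++)
  open import Data.List.Membership.Propositional using (_∈_; _∉_)
  open import Data.List.Membership.Propositional.Properties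
    using (∈-∃++; ∈-++⁺ˡ; ∈-++⁺ʳ; ∈-++⁻; ∈-filter⁺; ∈-filter⁻; ∈-allFin)
  import Data.List.Membership.DecPropositional as DecMembership
  open import Data.List.Relation.Unary.Any using (here; there)
  import Data.List.Relation.Unary.All as All
  open import Data.List.Relation.Unary.Unique.Propositional using (Unique; []; _∷_)
  import Data.List.Relation.Unary.Unique.Propositional.Properties as Unique
  open import Data.Product using (_×_; _,_; proj₂)
  open import Data.Sum using (_⊎_; inj₁; inj₂)
  open import Function using (_∘_; id)
  open import Relation.Nullary using (yes; no; does; contradiction)
  open import Relation.Binary.PropositionalEquality

  Unique-⊆⇒length≤ : ∀ {A : Set} {xs ys : List A} → Unique xs → (∀ {x} → x ∈ xs → x ∈ ys) →
                     length xs ≤ length ys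
  Unique-⊆⇒length≤ [] _ = z≤n
  Unique-⊆⇒length≤ {xs = x ∷ xs} (x∉xs ∷ unique) xs⊆ys with ∈-∃++ (xs⊆ys (here refl))
  ... | as , bs , refl = begin
      suc (length xs)
    ≤⟨ s≤s (Unique-⊆⇒length≤ unique xs⊆as++bs) ⟩
      suc (length (as ++ bs))
    ≡⟨ cong suc (length-++ as) ⟩
      suc (length as + length bs)
    ≡⟨ sym (+-suc (length as) (length bs)) ⟩
      length as + length (x ∷ bs)
    ≡⟨ sym (length-++ as) ⟩
      length (as ++ x ∷ bs) ∎
    where
    open ≤-Reasoning
    xs⊆as++bs : ∀ {z} → z ∈ xs → z ∈ as ++ bs
    xs⊆as++bs z∈xs with ∈-++⁻ as (xs⊆ys (there z∈xs))
    ... | inj₁ z∈as         = ∈-++⁺ˡ z∈as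
    ... | inj₂ (here z≡x)   = contradiction (sym z≡x) (All.lookup x∉xs z∈xs)
    ... | inj₂ (there z∈bs) = ∈-++⁺ʳ as z∈bs

  length-filterᵇ-tabulate : ∀ {A : Set} {m} (q : A → Bool) (g : Fin m → A) →
                            length (filterᵇ q (tabulate g)) ≡ ∣ Vec.tabulate (q ∘ g) ∣
  length-filterᵇ-tabulate {m = zero}  q g = refl
  length-filterᵇ-tabulate {m = suc m} q g with q (g zero)
  ... | true  = cong suc (length-filterᵇ-tabulate q (g ∘ suc))
  ... | false = length-filterᵇ-tabulate q (g ∘ suc)

  length-filterᵇ-partition : ∀ {A : Set} (q : A → Bool) xs →
                             length (filterᵇ q xs) + length (filterᵇ (not ∘ q) xs) ≡ length xs
  length-filterᵇ-partition q []       = refl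
  length-filterᵇ-partition q (x ∷ xs) with q x
  ... | true  = cong suc (length-filterᵇ-partition q xs)
  ... | false = trans (+-suc _ _) (cong suc (length-filterᵇ-partition q xs))

  -- Multiply both sides by D^(D - s) ≤ (1 + D)^(D - s).
  [1+D]^[1+s]<D^s*K : ∀ D K s → s ≤ D → suc D ^ suc D < D ^ D * K → suc D ^ suc s < D ^ s * K
  [1+D]^[1+s]<D^s*K D K s s≤D lll = *-cancelʳ-< (D ^ r) (suc D ^ suc s) (D ^ s * K) (begin-strict
      suc D ^ suc s * D ^ r
    ≤⟨ *-monoʳ-≤ (suc D ^ suc s) (^-monoˡ-≤ r (n≤1+n D)) ⟩
      suc D ^ suc s * suc D ^ r
    ≡⟨ sym (^-distribˡ-+-* (suc D) (suc s) r) ⟩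
      suc D ^ suc (s + r)
    ≡⟨ cong (λ x → suc D ^ suc x) s+r≡D ⟩
      suc D ^ suc D
    <⟨ lll ⟩
      D ^ D * K
    ≡⟨ cong (λ x → D ^ x * K) (sym s+r≡D) ⟩
      D ^ (s + r) * K
    ≡⟨ cong (_* K) (^-distribˡ-+-* D s r) ⟩
      D ^ s * D ^ r * K
    ≡⟨ rearrange (D ^ s) (D ^ r) K ⟩
      D ^ s * K * D ^ r ∎)
    where
    open ≤-Reasoning
    r = D ∸ s
    s+r≡D : s + r ≡ D
    s+r≡D = m+[n∸m]≡n s≤D
    rearrange : ∀ a b c → a * b * c ≡ a * c * b
    rearrange = solve-∀

  module UniformHypergraph (k : ℕ) ⦃ _ : NonZero k ⦄ {n m : ℕ} (E : Fin m → Subset n)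
                           (t : ℕ) (uniform : ∀ i → ∣ E i ∣ ≡ suc t) where

    open Colourings k
    open DecMembership (_≟_ {m}) using (_∈?_)

    -- each edge is monochromatic with probability at most 1/K
    K : ℕ
    K = k ^ t

    avoids : List (Fin m) → Colouring n → Bool
    avoids []      f = true
    avoids (j ∷ S) f = not (monochromatic (E j) f) ∧ avoids S f

    #avoiding : List (Fin m) → ℕ
    #avoiding S = ∑ᶜ (𝟙 ∘ avoids S)

    #monoAvoiding : Fin m → List (Fin m) → ℕ
    #monoAvoiding i S = ∑ᶜ (λ f → 𝟙 (monochromatic (E i) f) * 𝟙 (avoids S f))

    #avoiding[] : #avoiding [] ≡ k ^ n
    #avoiding[] = trans (∑ᶜ-const n 1) (*-identityʳ (k ^ n))

    #avoiding-∷ : ∀ i S → #avoiding (i ∷ S) + #monoAvoiding i S ≡ #avoiding S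
    #avoiding-∷ i S = trans (sym (∑ᶜ-distrib-+ (𝟙 ∘ avoids (i ∷ S)) _))
                            (∑ᶜ-cong λ f → split (monochromatic (E i) f) (avoids S f))
      where
      split : ∀ a b → 𝟙 (not a ∧ b) + 𝟙 a * 𝟙 b ≡ 𝟙 b
      split true  true  = refl
      split true  false = refl
      split false true  = refl
      split false false = refl

    #monoAvoiding*K≤ : ∀ i S → #monoAvoiding i S * K ≤ k ^ n
    #monoAvoiding*K≤ i S = begin
        #monoAvoiding i S * K
      ≤⟨ *-monoˡ-≤ K (∑ᶜ-mono-≤ λ f → *-monoʳ-≤ (𝟙 (monochromatic (E i) f)) (𝟙≤1 (avoids S f))) ⟩
        ∑ᶜ (λ f → 𝟙 (monochromatic (E i) f) * 1) * K
      ≤⟨ ∑ᶜ-monochromatic (E i) t (λ _ → 1) (λ _ _ _ → refl) (uniform i) ⟩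
        ∑ᶜ {n} (λ _ → 1)
      ≡⟨ #avoiding[] ⟩
        k ^ n ∎
      where open ≤-Reasoning

    union-bound : ∀ S → K * k ^ n ≤ K * #avoiding S + length S * k ^ n
    union-bound []      = ≤-reflexive (trans (cong (K *_) (sym #avoiding[])) (sym (+-identityʳ _)))
    union-bound (j ∷ S) = begin
        K * k ^ n
      ≤⟨ union-bound S ⟩
        K * #avoiding S + length S * k ^ n
      ≡⟨ cong (λ x → K * x + length S * k ^ n) (sym (#avoiding-∷ j S)) ⟩
        K * (#avoiding (j ∷ S) + #monoAvoiding j S) + length S * k ^ n
      ≡⟨ rearrange K (#avoiding (j ∷ S)) (#monoAvoiding j S) (length S * k ^ n) ⟩
        K * #avoiding (j ∷ S) + (#monoAvoiding j S * K + length S * k ^ n)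
      ≤⟨ +-monoʳ-≤ (K * #avoiding (j ∷ S)) (+-monoˡ-≤ (length S * k ^ n) (#monoAvoiding*K≤ j S)) ⟩
        K * #avoiding (j ∷ S) + (k ^ n + length S * k ^ n) ∎
      where
      open ≤-Reasoning
      rearrange : ∀ K a b c → K * (a + b) + c ≡ K * a + (b * K + c)
      rearrange = solve-∀

    length<K⇒#avoiding>0 : ∀ S → length S < K → 0 < #avoiding S
    length<K⇒#avoiding>0 S |S|<K = n≢0⇒n>0 λ #avoiding≡0 → <-irrefl refl (begin-strict
        K * k ^ n
      ≤⟨ union-bound S ⟩
        K * #avoiding S + length S * k ^ n
      ≡⟨ cong (λ x → K * x + length S * k ^ n) #avoiding≡0 ⟩
        K * 0 + length S * k ^ n
      ≡⟨ cong (_+ length S * k ^ n) (*-zeroʳ K) ⟩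
        length S * k ^ n
      <⟨ *-monoˡ-< (k ^ n) ⦃ >-nonZero (m^n>0 k n) ⦄ |S|<K ⟩
        K * k ^ n ∎)
      where open ≤-Reasoning

    avoids-++ : ∀ xs ys f → avoids (xs ++ ys) f ≡ avoids xs f ∧ avoids ys f
    avoids-++ []       ys f = refl
    avoids-++ (x ∷ xs) ys f = trans (cong (not (monochromatic (E x) f) ∧_) (avoids-++ xs ys f))
                                    (sym (∧-assoc (not (monochromatic (E x) f)) _ _))

    avoids-partition : ∀ (q : Fin m → Bool) S f → avoids S f ≡ avoids (filterᵇ q S ++ filterᵇ (not ∘ q) S) f
    avoids-partition q []      f = refl
    avoids-partition q (j ∷ S) f with q j
    ... | true  = cong (not (monochromatic (E j) f) ∧_) (avoids-partition q S f)
    ... | false = begin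
        a ∧ avoids S f
      ≡⟨ cong (a ∧_) (avoids-partition q S f) ⟩
        a ∧ avoids (S₁ ++ S₂) f
      ≡⟨ cong (a ∧_) (avoids-++ S₁ S₂ f) ⟩
        a ∧ (avoids S₁ f ∧ avoids S₂ f)
      ≡⟨ ∧-middle a (avoids S₁ f) (avoids S₂ f) ⟩
        avoids S₁ f ∧ (a ∧ avoids S₂ f)
      ≡⟨ sym (avoids-++ S₁ (j ∷ S₂) f) ⟩
        avoids (S₁ ++ j ∷ S₂) f ∎
      where
      open ≡-Reasoning
      a = not (monochromatic (E j) f)
      S₁ = filterᵇ q S
      S₂ = filterᵇ (not ∘ q) S
      ∧-middle : ∀ a b c → a ∧ (b ∧ c) ≡ b ∧ (a ∧ c)
      ∧-middle true  b c = refl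
      ∧-middle false b c = sym (∧-zeroʳ b)

    #avoiding-partition : ∀ q S → #avoiding S ≡ #avoiding (filterᵇ q S ++ filterᵇ (not ∘ q) S)
    #avoiding-partition q S = ∑ᶜ-cong (cong 𝟙 ∘ avoids-partition q S)

    #monoAvoiding-filterᵇ : ∀ i q S → #monoAvoiding i S ≤ #monoAvoiding i (filterᵇ (not ∘ q) S)
    #monoAvoiding-filterᵇ i q S = ∑ᶜ-mono-≤ λ f → *-monoʳ-≤ (𝟙 (monochromatic (E i) f)) (begin
        𝟙 (avoids S f)
      ≡⟨ cong 𝟙 (trans (avoids-partition q S f) (avoids-++ (filterᵇ q S) _ f)) ⟩
        𝟙 (avoids (filterᵇ q S) f ∧ avoids (filterᵇ (not ∘ q) S) f)
      ≤⟨ 𝟙-∧-≤ʳ (avoids (filterᵇ q S) f) _ ⟩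
        𝟙 (avoids (filterᵇ (not ∘ q) S) f) ∎)
      where
      open ≤-Reasoning
      𝟙-∧-≤ʳ : ∀ a b → 𝟙 (a ∧ b) ≤ 𝟙 b
      𝟙-∧-≤ʳ true  b = ≤-refl
      𝟙-∧-≤ʳ false b = z≤n

    avoids⇒¬monochromatic : ∀ {j} S f → avoids S f ≡ true → j ∈ S → monochromatic (E j) f ≡ false
    avoids⇒¬monochromatic (j ∷ S) f avoids-jS (here refl) with monochromatic (E j) f
    ... | false = refl
    avoids⇒¬monochromatic (j ∷ S) f avoids-jS (there j∈) with monochromatic (E j) f
    ... | false = avoids⇒¬monochromatic S f avoids-jS j∈

    ∈⇒#monoAvoiding≡0 : ∀ i S → i ∈ S → #monoAvoiding i S ≡ 0
    ∈⇒#monoAvoiding≡0 i S i∈S = trans (∑ᶜ-cong λ f → never f) (trans (∑ᶜ-const n 0) (*-zeroʳ (k ^ n)))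
      where
      never : ∀ f → 𝟙 (monochromatic (E i) f) * 𝟙 (avoids S f) ≡ 0
      never f with monochromatic (E i) f in mono
      ... | false = refl
      ... | true  = trans (+-identityʳ _) (cong 𝟙 (excluded S i∈S))
        where
        excluded : ∀ S → i ∈ S → avoids S f ≡ false
        excluded (.i ∷ S) (here refl) rewrite mono = refl
        excluded (j ∷ S)  (there i∈S) rewrite excluded S i∈S = ∧-zeroʳ _

    SharesNoVertex : Fin m → Fin m → Set
    SharesNoVertex i j = ∀ v → lookup (E i) v ≡ true → lookup (E j) v ≡ false

    ¬isInc⇒SharesNoVertex : ∀ i j → i ≢ j → isInc E i j ≡ false → SharesNoVertex i j
    ¬isInc⇒SharesNoVertex i j i≢j ¬inc v v∈Ei with i ≟ j
    ... | yes i≡j = contradiction i≡j i≢j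
    ... | no  _   = begin
        lookup (E j) v
      ≡⟨ cong (_∧ lookup (E j) v) (sym v∈Ei) ⟩
        lookup (E i) v ∧ lookup (E j) v
      ≡⟨ sym (lookup-zipWith _∧_ v (E i) (E j)) ⟩
        lookup (E i ∩ E j) v
      ≡⟨ ∣p∣≡0⇒∉ (E i ∩ E j) (0<ᵇ≡false ¬inc) v ⟩
        false ∎
      where
      open ≡-Reasoning
      0<ᵇ≡false : ∀ {x} → (0 <ᵇ x) ≡ false → x ≡ 0
      0<ᵇ≡false {zero} _ = refl
      ∣p∣≡0⇒∉ : ∀ {n} (p : Subset n) → ∣ p ∣ ≡ 0 → ∀ v → lookup p v ≡ false
      ∣p∣≡0⇒∉ (false ∷ p) ∣p∣≡0 zero    = refl
      ∣p∣≡0⇒∉ (false ∷ p) ∣p∣≡0 (suc v) = ∣p∣≡0⇒∉ p ∣p∣≡0 v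

    monochromaticIn-local : ∀ {n} c (e : Subset n) {f g : Colouring n} →
                            (∀ v → lookup e v ≡ true → f v ≡ g v) → monochromaticIn c e f ≡ monochromaticIn c e g
    monochromaticIn-local c []          agree = refl
    monochromaticIn-local c (true ∷ e)  agree =
      cong₂ (λ x y → does (x ≟ c) ∧ y) (agree zero refl) (monochromaticIn-local c e (agree ∘ suc))
    monochromaticIn-local c (false ∷ e) agree = monochromaticIn-local c e (agree ∘ suc)

    avoids-ignores : ∀ i S → (∀ {j} → j ∈ S → SharesNoVertex i j) → IgnoresColoursOn (E i) (𝟙 ∘ avoids S)
    avoids-ignores i S disjoint f g agree = cong 𝟙 (go S disjoint)
      where
      go : ∀ S → (∀ {j} → j ∈ S → SharesNoVertex i j) → avoids S f ≡ avoids S g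
      go []      _        = refl
      go (j ∷ S) disjoint = cong₂ (λ x y → not x ∧ y)
        (foldr-cong _∨_ false λ c → monochromaticIn-local c (E j) agree-on-Ej) (go S (disjoint ∘ there))
        where
        agree-on-Ej : ∀ v → lookup (E j) v ≡ true → f v ≡ g v
        agree-on-Ej v v∈Ej with lookup (E i) v in v∈?Ei
        ... | false = agree v v∈?Ei
        ... | true  = contradiction (trans (sym v∈Ej) (disjoint (here refl) v v∈?Ei)) λ ()

    #monoAvoiding*K≤#avoiding : ∀ i S → (∀ {j} → j ∈ S → SharesNoVertex i j) →
                                #monoAvoiding i S * K ≤ #avoiding S
    #monoAvoiding*K≤#avoiding i S disjoint =
      ∑ᶜ-monochromatic (E i) t (𝟙 ∘ avoids S) (avoids-ignores i S disjoint) (uniform i)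

    length-neighbours≤degree : ∀ i S → Unique S → length (filterᵇ (isInc E i) S) ≤ degree E i
    length-neighbours≤degree i S unique = begin
        length (filterᵇ (isInc E i) S)
      ≤⟨ Unique-⊆⇒length≤ (Unique.filter⁺ neighbour? unique)
           (λ j∈ → ∈-filter⁺ neighbour? (∈-allFin _) (proj₂ (∈-filter⁻ neighbour? {xs = S} j∈))) ⟩
        length (filterᵇ (isInc E i) (allFin m))
      ≡⟨ length-filterᵇ-tabulate (isInc E i) id ⟩
        degree E i ∎
      where
      open ≤-Reasoning
      neighbour? = T? ∘ isInc E i

    Unique-partition : ∀ (q : Fin m → Bool) S → Unique S → Unique (filterᵇ q S ++ filterᵇ (not ∘ q) S)
    Unique-partition q S unique =
      Unique.++⁺ (Unique.filter⁺ (T? ∘ q) unique) (Unique.filter⁺ (T? ∘ not ∘ q) unique) λ (j∈₁ , j∈₂) →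
        T-not (proj₂ (∈-filter⁻ (T? ∘ q) {xs = S} j∈₁)) (proj₂ (∈-filter⁻ (T? ∘ not ∘ q) {xs = S} j∈₂))
      where
      T-not : ∀ {b} → T b → T (not b) → ⊥
      T-not {true} _ ()

    non-neighbours-share-no-vertex : ∀ i S → i ∉ S →
                                     ∀ {j} → j ∈ filterᵇ (not ∘ isInc E i) S → SharesNoVertex i j
    non-neighbours-share-no-vertex i S i∉S {j} j∈ with ∈-filter⁻ (T? ∘ not ∘ isInc E i) {xs = S} j∈
    ... | j∈S , ¬inc = ¬isInc⇒SharesNoVertex i j (λ { refl → i∉S j∈S }) (T-not⇒≡false ¬inc)
      where
      T-not⇒≡false : ∀ {b} → T (not b) → b ≡ false
      T-not⇒≡false {false} _ = refl

    module _ (D : ℕ) (degree≤D : ∀ i → degree E i ≤ D) (lll : suc D ^ suc D < D ^ D * K) where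

      -- Given that no edge of S is monochromatic, edge i is monochromatic with probability < 1/(D+1).
      Unlikely : Fin m → List (Fin m) → Set
      Unlikely i S = #monoAvoiding i S ≡ 0 ⊎ suc D * #monoAvoiding i S < #avoiding S

      UnlikelyBelow : ℕ → Set
      UnlikelyBelow ℓ = ∀ S → length S < ℓ → Unique S → ∀ i → Unlikely i S

      #avoiding-∷-≥ : ∀ j S → Unlikely j S → D * #avoiding S ≤ suc D * #avoiding (j ∷ S)
      #avoiding-∷-≥ j S unlikely = +-cancelʳ-≤ (suc D * M) (D * #avoiding S) (suc D * #avoiding (j ∷ S)) (begin
          D * #avoiding S + suc D * M
        ≤⟨ +-monoʳ-≤ (D * #avoiding S) (weaken unlikely) ⟩
          D * #avoiding S + #avoiding S
        ≡⟨ cong (λ x → D * x + x) (sym (#avoiding-∷ j S)) ⟩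
          D * (#avoiding (j ∷ S) + M) + (#avoiding (j ∷ S) + M)
        ≡⟨ rearrange D (#avoiding (j ∷ S)) M ⟩
          suc D * #avoiding (j ∷ S) + suc D * M ∎)
        where
        open ≤-Reasoning
        M = #monoAvoiding j S
        weaken : Unlikely j S → suc D * M ≤ #avoiding S
        weaken (inj₁ M≡0) rewrite M≡0 | *-zeroʳ D = z≤n
        weaken (inj₂ lt)  = <⇒≤ lt
        rearrange : ∀ D a b → D * (a + b) + (a + b) ≡ suc D * a + suc D * b
        rearrange = solve-∀

      #avoiding-++-≥ : ∀ {ℓ} → UnlikelyBelow ℓ → ∀ T U → Unique (T ++ U) → length (T ++ U) ≤ ℓ →
                       D ^ length T * #avoiding U ≤ suc D ^ length T * #avoiding (T ++ U)
      #avoiding-++-≥ below []      U _ _ = ≤-refl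
      #avoiding-++-≥ below (j ∷ T) U (_ ∷ unique) |jTU|≤ℓ = begin
          D * D ^ length T * #avoiding U
        ≡⟨ *-assoc D (D ^ length T) (#avoiding U) ⟩
          D * (D ^ length T * #avoiding U)
        ≤⟨ *-monoʳ-≤ D (#avoiding-++-≥ below T U unique (<⇒≤ |jTU|≤ℓ)) ⟩
          D * (suc D ^ length T * #avoiding (T ++ U))
        ≡⟨ *-comm-middle D (suc D ^ length T) (#avoiding (T ++ U)) ⟩
          suc D ^ length T * (D * #avoiding (T ++ U))
        ≤⟨ *-monoʳ-≤ (suc D ^ length T) (#avoiding-∷-≥ j (T ++ U) (below (T ++ U) |jTU|≤ℓ unique j)) ⟩
          suc D ^ length T * (suc D * #avoiding (j ∷ T ++ U))
        ≡⟨ *-comm-middle (suc D ^ length T) (suc D) _ ⟩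
          suc D * (suc D ^ length T * #avoiding (j ∷ T ++ U))
        ≡⟨ sym (*-assoc (suc D) (suc D ^ length T) _) ⟩
          suc D * suc D ^ length T * #avoiding (j ∷ T ++ U) ∎
        where
        open ≤-Reasoning
        *-comm-middle : ∀ a b c → a * (b * c) ≡ b * (a * c)
        *-comm-middle = solve-∀

      -- Split S into the neighbours of i (at most D of them) and the rest, which is independent of edge i.
      strictly-unlikely : ∀ S i → UnlikelyBelow (length S) → Unique S → i ∉ S → 0 < #monoAvoiding i S →
                          suc D * #monoAvoiding i S < #avoiding S
      strictly-unlikely S i below unique i∉S M>0 = *-cancelˡ-< (suc D ^ s) (suc D * M) (#avoiding S) (begin-strict
          suc D ^ s * (suc D * M)
        ≡⟨ reassociate (suc D ^ s) (suc D) M ⟩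
          suc D ^ suc s * M
        <⟨ *-monoˡ-< M ⦃ >-nonZero M>0 ⦄ ([1+D]^[1+s]<D^s*K D K s s≤D lll) ⟩
          D ^ s * K * M
        ≡⟨ rearrange (D ^ s) K M ⟩
          D ^ s * (M * K)
        ≤⟨ *-monoʳ-≤ (D ^ s) (*-monoˡ-≤ K (#monoAvoiding-filterᵇ i (isInc E i) S)) ⟩
          D ^ s * (#monoAvoiding i S₂ * K)
        ≤⟨ *-monoʳ-≤ (D ^ s) (#monoAvoiding*K≤#avoiding i S₂ (non-neighbours-share-no-vertex i S i∉S)) ⟩
          D ^ s * #avoiding S₂
        ≤⟨ #avoiding-++-≥ below S₁ S₂ (Unique-partition (isInc E i) S unique)
             (≤-reflexive (trans (length-++ S₁) (length-filterᵇ-partition (isInc E i) S))) ⟩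
          suc D ^ s * #avoiding (S₁ ++ S₂)
        ≡⟨ cong (suc D ^ s *_) (sym (#avoiding-partition (isInc E i) S)) ⟩
          suc D ^ s * #avoiding S ∎)
        where
        open ≤-Reasoning
        M = #monoAvoiding i S
        S₁ = filterᵇ (isInc E i) S
        S₂ = filterᵇ (not ∘ isInc E i) S
        s = length S₁
        s≤D : s ≤ D
        s≤D = ≤-trans (length-neighbours≤degree i S unique) (degree≤D i)
        reassociate : ∀ a b c → a * (b * c) ≡ b * a * c
        reassociate = solve-∀
        rearrange : ∀ a b c → a * b * c ≡ a * (c * b)
        rearrange = solve-∀

      unlikely-step : ∀ S → UnlikelyBelow (length S) → Unique S → ∀ i → Unlikely i S
      unlikely-step S below unique i with i ∈? S
      ... | yes i∈S = inj₁ (∈⇒#monoAvoiding≡0 i S i∈S)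
      ... | no  i∉S = zero-or {λ x → suc D * x < #avoiding S} (#monoAvoiding i S) (strictly-unlikely S i below unique i∉S)
        where
        zero-or : ∀ {P : ℕ → Set} x → (0 < x → P x) → x ≡ 0 ⊎ P x
        zero-or zero    _     = inj₁ refl
        zero-or (suc x) x>0⇒P = inj₂ (x>0⇒P z<s)

      unlikely-below : ∀ ℓ → UnlikelyBelow ℓ
      unlikely-below (suc ℓ) S |S|<1+ℓ = unlikely-step S λ S′ |S′|<|S| →
        unlikely-below ℓ S′ (<-≤-trans |S′|<|S| (≤-pred |S|<1+ℓ))

      #avoiding>0 : ∀ S → Unique S → 0 < #avoiding S
      #avoiding>0 []      _            = subst (0 <_) (sym #avoiding[]) (m^n>0 k n)
      #avoiding>0 (j ∷ S) (_ ∷ unique) = n≢0⇒n>0 λ #avoiding-jS≡0 →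
        let M≡#avoiding-S = trans (cong (_+ #monoAvoiding j S) (sym #avoiding-jS≡0)) (#avoiding-∷ j S)
        in contradiction M≡#avoiding-S (leftover (unlikely-step S (unlikely-below (length S)) unique j))
        where
        leftover : Unlikely j S → #monoAvoiding j S ≢ #avoiding S
        leftover (inj₁ M≡0) M≡G = <⇒≢ (#avoiding>0 S unique) (sym (trans (sym M≡G) M≡0))
        leftover (inj₂ lt)  M≡G = <⇒≱ lt (≤-trans (≤-reflexive (sym M≡G)) (m≤n*m _ (suc D)))

open ExpNumerator using ([1+d]^[1+d]<d^d*K)
open ExpPartial using (e<⇒expNumerator-bound)
open Counting
open LocalLemma
open import Data.Nat using (ℕ; zero; suc; _*_; _≤_; _<_; _^_; _∸_; z≤n; s≤s; NonZero)
open import Data.Nat.Properties using (≤-trans; ≤-reflexive; m≤n⇒m≤1+n)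
import Data.Nat as ℕ
open import Data.Bool using (true; false)
open import Data.Fin using (Fin; zero; suc; toℕ)
open import Data.Fin.Properties using (toℕ-injective; toℕ<n)
open import Data.Fin.Subset using (Subset; ∣_∣)
open import Data.Fin.Subset.Properties using (_∈?_)
open import Data.Vec using (_∷_; lookup)
open import Data.Vec.Properties using (lookup⇒[]=)
open import Data.List using (_∷_; length; map; deduplicate; allFin; upTo)
open import Data.List.Properties using (length-upTo; length-tabulate)
open import Data.List.Membership.Propositional using (_∈_)
open import Data.List.Membership.Propositional.Properties
  using (∈-map⁺; ∈-map⁻; ∈-filter⁺; ∈-allFin; ∈-deduplicate⁺; ∈-deduplicate⁻; ∈-upTo⁺)
open import Data.List.Relation.Unary.Any using (here; there)
import Data.List.Relation.Unary.All as All
open import Data.List.Relation.Unary.Unique.DecPropositional.Properties using (deduplicate-!)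
open import Data.List.Relation.Unary.Unique.Propositional.Properties using (allFin⁺)
open import Data.List.Extrema.Nat using (argmax; f[xs]≤f[argmax])
open import Data.Integer using (+_)
open import Data.Rational using (_/_)
open import Data.Sum using (_⊎_; inj₁; inj₂)
open import Data.Product using (∃; _,_)
open import Function using (_∘_; id)
open import Relation.Nullary using (contradiction)
open import Relation.Binary.PropositionalEquality

∈-∈-≢⇒2≤length : ∀ {A : Set} {x y : A} xs → x ∈ xs → y ∈ xs → x ≢ y → 2 ≤ length xs
∈-∈-≢⇒2≤length (a ∷ xs)     (here refl) (here refl) x≢y = contradiction refl x≢y
∈-∈-≢⇒2≤length (a ∷ b ∷ xs) (here _)    (there _)   _   = s≤s (s≤s z≤n)
∈-∈-≢⇒2≤length (a ∷ b ∷ xs) (there _)   (here _)    _   = s≤s (s≤s z≤n)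
∈-∈-≢⇒2≤length (a ∷ xs)     (there x∈)  (there y∈)  x≢y = m≤n⇒m≤1+n (∈-∈-≢⇒2≤length xs x∈ y∈ x≢y)

∣p∣>0⇒∃∈ : ∀ {n} (p : Subset n) → 0 < ∣ p ∣ → ∃ λ v → lookup p v ≡ true
∣p∣>0⇒∃∈ (true ∷ p)  _       = zero , refl
∣p∣>0⇒∃∈ (false ∷ p) ∣p∣>0 with ∣p∣>0⇒∃∈ p ∣p∣>0
... | v , v∈p = suc v , v∈p

module _ {k n : ℕ} (f : Fin n → Fin k) (e : Subset n) where

  open Colourings k using (monochromatic; monochromatic≡false⇒; monochromaticIn≡false⇒)

  colour∈ : ∀ {v} → lookup e v ≡ true → toℕ (f v) ∈ deduplicate ℕ._≟_ (map (toℕ ∘ f) (elems e))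
  colour∈ {v} v∈e =
    ∈-deduplicate⁺ ℕ._≟_ (∈-map⁺ (toℕ ∘ f) (∈-filter⁺ (_∈? e) (∈-allFin v) (lookup⇒[]= v e v∈e)))

  colourCount≤ : colourCount (toℕ ∘ f) e ≤ k
  colourCount≤ = ≤-trans (Unique-⊆⇒length≤ (deduplicate-! ℕ._≟_ _) colour<k) (≤-reflexive (length-upTo k))
    where
    colour<k : ∀ {x} → x ∈ deduplicate ℕ._≟_ (map (toℕ ∘ f) (elems e)) → x ∈ upTo k
    colour<k x∈ with ∈-map⁻ (toℕ ∘ f) (∈-deduplicate⁻ ℕ._≟_ (map (toℕ ∘ f) (elems e)) x∈)
    ... | v , _ , refl = ∈-upTo⁺ (toℕ<n (f v))

  colourCount≥2 : 0 < ∣ e ∣ → monochromatic e f ≡ false → 1 < colourCount (toℕ ∘ f) e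
  colourCount≥2 ∣e∣>0 ¬mono with ∣p∣>0⇒∃∈ e ∣e∣>0
  ... | u , u∈e with monochromaticIn≡false⇒ e (f u) f (monochromatic≡false⇒ e f (f u) ¬mono)
  ...   | v , v∈e , fv≢fu = ∈-∈-≢⇒2≤length _ (colour∈ u∈e) (colour∈ v∈e) (fv≢fu ∘ sym ∘ toℕ-injective)

module _ {n m : ℕ} (k : ℕ) ⦃ _ : NonZero k ⦄ (E : Fin m → Subset n) (uniform : ∀ i → ∣ E i ∣ ≡ suc k) where

  open Colourings k using (∑ᶜ>0⇒∃>0)
  open UniformHypergraph k E k uniform

  #avoiding>0⇒Colourable : 0 < #avoiding (allFin m) → Colourable E
  #avoiding>0⇒Colourable #avoiding>0 with ∑ᶜ>0⇒∃>0 (𝟙 ∘ avoids (allFin m)) #avoiding>0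
  ... | f , f-avoids = toℕ ∘ f , λ j →
      colourCount≥2 f (E j) (subst (0 <_) (sym (uniform j)) (s≤s z≤n))
                    (avoids⇒¬monochromatic (allFin m) f (𝟙>0 f-avoids) (∈-allFin j))
    , subst (colourCount (toℕ ∘ f) (E j) <_) (sym (uniform j)) (s≤s (colourCount≤ f (E j)))
    where
    𝟙>0 : ∀ {b} → 0 < 𝟙 b → b ≡ true
    𝟙>0 {true} _ = refl

  few-edges⇒Colourable : m < k ^ k → Colourable E
  few-edges⇒Colourable m<K =
    #avoiding>0⇒Colourable (length<K⇒#avoiding>0 (allFin m) (subst (_< K) (sym (length-tabulate id)) m<K))

  bounded-degree⇒Colourable : ∀ D → (∀ i → degree E i ≤ D) → suc D ^ suc D < D ^ D * k ^ k → Colourable E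
  bounded-degree⇒Colourable D degree≤D lll = #avoiding>0⇒Colourable (#avoiding>0 D degree≤D lll (allFin m) (allFin⁺ m))

theorem1p1 : (r n m : ℕ) → 2 ≤ r → (E : Fin m → Subset n) →
    Uniform r E → Sperner E →
    (m < (r ∸ 1) ^ (r ∸ 1)
      ⊎ ((i : Fin m) → e< ((+ ((r ∸ 1) ^ (r ∸ 1))) / suc (degree E i)))) →
    Colourable E
theorem1p1 .(suc (suc k)) n zero    (s≤s (s≤s {n = k} z≤n)) E uniform _ _ = (λ _ → 0) , λ ()
theorem1p1 .(suc (suc k)) n (suc m) (s≤s (s≤s {n = k} z≤n)) E uniform _ (inj₁ few-edges) =
  few-edges⇒Colourable (suc k) E uniform few-edges
theorem1p1 .(suc (suc k)) n (suc m) (s≤s (s≤s {n = k} z≤n)) E uniform _ (inj₂ e[1+degree]<K) =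
  bounded-degree⇒Colourable (suc k) E uniform Δ degree≤Δ
    ([1+d]^[1+d]<d^d*K Δ K (e<⇒expNumerator-bound Δ K (e[1+degree]<K i*)))
  where
  i* = argmax (degree E) zero (allFin (suc m))
  Δ = degree E i*
  K = suc k ^ suc k
  degree≤Δ : ∀ i → degree E i ≤ Δ
  degree≤Δ i = All.lookup (f[xs]≤f[argmax] {f = degree E} zero (allFin (suc m))) (∈-allFin i)
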